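{- Let $a,b,c,d$ be four distinct letters, $\Sigma=\{a,b,c,d\}$, let $f_{m,n}$ be the two-dimensional Fibonacci arrays defined in the context, and let $\mu$ be the map defined in the context. Then for all $m,n\ge1$, the image $\mu(f_{m,n})$ is defined and $\mu(f_{m,n})=f_{m+1,n+1}$.
   Context: For arrays $u,v$ with equal numbers of rows, $u\circ_c v$ places $v$ to the right of $u$; with equal numbers of columns, $u\circ_r v$ places $v$ below $u$. Two-dimensional Fibonacci arrays: $f_{0,0}=a$, $f_{0,1}=b$, $f_{1,0}=c$, $f_{1,1}=d$, and for $k\ge0$, $m,n\ge1$: $f_{k,n+1}=f_{k,n}\circ_c f_{k,n-1}$, $f_{m+1,k}=f_{m,k}\circ_r f_{m-1,k}$. The map $\mu$ assigns to each letter an array: $\mu(d)=\begin{smallmatrix} d & c\\ b & a\end{smallmatrix}$ (size $2\times2$), $\mu(c)=\begin{smallmatrix} d\\ b\end{smallmatrix}$ (size $2\times1$), $\mu(b)=\begin{smallmatrix} d & c\end{smallmatrix}$ (size $1\times2$), $\mu(a)=d$. For an array $x=[x_{i,j}]$ of size $(p,q)$ such that, for each row index $i$, all $\mu(x_{i,j})$ ($1\le j\le q$) have the same number of rows, and for each column index $j$, all $\mu(x_{i,j})$ ($1\le i\le p$) have the same number of columns, the image is $\mu(x)=R_1\circ_r R_2\circ_r\cdots\circ_r R_p$ where $R_i=\mu(x_{i,1})\circ_c\cdots\circ_c\mu(x_{i,q})$. -}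

module Defs where

open import Data.Nat using (ℕ; zero; suc; _+_)
open import Data.Fin using (Fin)
open import Data.Vec as Vec using (Vec; []; _∷_; lookup)
open import Data.List as List using (List; []; _∷_)
open import Relation.Binary.PropositionalEquality using (_≡_)

data Letter : Set where
  a b c d : Letter

-- A (p × q) array over Σ: a vector of p rows, each a vector of q letters.
Array : ℕ → ℕ → Set
Array p q = Vec (Vec Letter q) p

_∘c_ : ∀ {p q r} → Array p q → Array p r → Array p (q + r)
u ∘c v = Vec.zipWith Vec._++_ u v

_∘r_ : ∀ {p r q} → Array p q → Array r q → Array (p + r) q
u ∘r v = u Vec.++ v

F : ℕ → ℕ
F zero = 1
F (suc zero) = 1
F (suc (suc n)) = F (suc n) + F n

-- Columns 0 and 1 are generated by the
-- row rule f_{m+1,k} = f_{m,k} ∘r f_{m-1,k} from a,c (k = 0) and b,d (k = 1);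
-- all further columns by the column rule f_{k,n+1} = f_{k,n} ∘c f_{k,n-1}.
-- (For m,n ≥ 2 the paper's two rules overlap; they agree by the interchange
-- law of ∘r and ∘c, so this choice is the paper's f.)
fibCol0 : (m : ℕ) → Array (F m) 1
fibCol0 zero = (a ∷ []) ∷ []
fibCol0 (suc zero) = (c ∷ []) ∷ []
fibCol0 (suc (suc m)) = fibCol0 (suc m) ∘r fibCol0 m

fibCol1 : (m : ℕ) → Array (F m) 1
fibCol1 zero = (b ∷ []) ∷ []
fibCol1 (suc zero) = (d ∷ []) ∷ []
fibCol1 (suc (suc m)) = fibCol1 (suc m) ∘r fibCol1 m

fib : (m n : ℕ) → Array (F m) (F n)
fib m zero = fibCol0 m
fib m (suc zero) = fibCol1 m
fib m (suc (suc n)) = fib m (suc n) ∘c fib m n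

μrows : Letter → ℕ
μrows d = 2
μrows c = 2
μrows b = 1
μrows a = 1

μcols : Letter → ℕ
μcols d = 2
μcols c = 1
μcols b = 2
μcols a = 1

-- μ on letters (arrays given row-wise as lists of lists).
μL : Letter → List (List Letter)
μL d = (d ∷ c ∷ []) ∷ (b ∷ a ∷ []) ∷ []
μL c = (d ∷ []) ∷ (b ∷ []) ∷ []
μL b = (d ∷ c ∷ []) ∷ []
μL a = (d ∷ []) ∷ []

μDefined : ∀ {p q} → Array p q → Set
μDefined {p} {q} x =
  (∀ (i : Fin p) (j j′ : Fin q) →
     μrows (lookup (lookup x i) j) ≡ μrows (lookup (lookup x i) j′))
  × (∀ (i i′ : Fin p) (j : Fin q) →
     μcols (lookup (lookup x i) j) ≡ μcols (lookup (lookup x i′) j))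
  where open import Data.Product using (_×_)

_∘cL_ : List (List Letter) → List (List Letter) → List (List Letter)
u ∘cL v = List.zipWith List._++_ u v

μRow : List Letter → List (List Letter)
μRow [] = []
μRow (x ∷ []) = μL x
μRow (x ∷ y ∷ ys) = μL x ∘cL μRow (y ∷ ys)

-- μ(x) = R_1 ∘r ⋯ ∘r R_p  (meaningful when μDefined x holds)
μImage : ∀ {p q} → Array p q → List (List Letter)
μImage x = List.concatMap (λ r → μRow (Vec.toList r)) (Vec.toList x)

toRows : ∀ {p q} → Array p q → List (List Letter)
toRows x = List.map Vec.toList (Vec.toList x)

-- The letter at position (i, j) of f_{m,n} is determined by two bits: the
-- i-th letter of the Fibonacci word of length F m and the j-th letter of the
-- Fibonacci word of length F n (over {1, 0}, with a = 00, b = 01, c = 10,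
-- d = 11).  So f_{m,n} is the "outer product" of two Fibonacci words, and μ
-- is the outer product of the Fibonacci morphism 1 ↦ 10, 0 ↦ 1 with itself.
-- Applying μ to an outer product thus applies the morphism to both words,
-- and the morphism maps each Fibonacci word to the next one.
{-# OPTIONS --safe #-}
module Submission where

open import Defs
open import Data.Nat using (ℕ; suc; zero; _≤_)
open import Data.Product using (_×_; _,_)
open import Data.Bool using (Bool; true; false)
open import Data.Empty using (⊥-elim)
open import Data.Vec as V using (Vec; lookup)
open import Data.List as L using (List; []; _∷_; _++_)
import Data.Vec.Properties as VP
import Data.List.Properties as LP
open import Relation.Binary.PropositionalEquality

letter : Bool → Bool → Letter
letter false false = a
letter false true  = b
letter true  false = c
letter true  true  = d

fibWord : (m : ℕ) → Vec Bool (F m)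
fibWord zero          = false V.∷ V.[]
fibWord (suc zero)    = true V.∷ V.[]
fibWord (suc (suc m)) = fibWord (suc m) V.++ fibWord m

infix 7 _⊗_ _⊗L_

_⊗_ : ∀ {p q} → Vec Bool p → Vec Bool q → Array p q
r ⊗ s = V.map (λ x → V.map (letter x) s) r

⊗-++ˡ : ∀ {p p′ q} (u : Vec Bool p) (v : Vec Bool p′) (s : Vec Bool q) →
  (u V.++ v) ⊗ s ≡ (u ⊗ s) ∘r (v ⊗ s)
⊗-++ˡ u v s = VP.map-++ _ u v

⊗-++ʳ : ∀ {p q q′} (r : Vec Bool p) (s : Vec Bool q) (t : Vec Bool q′) →
  r ⊗ (s V.++ t) ≡ (r ⊗ s) ∘c (r ⊗ t)
⊗-++ʳ V.[]       s t = refl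
⊗-++ʳ (x V.∷ r) s t = cong₂ V._∷_ (VP.map-++ (letter x) s t) (⊗-++ʳ r s t)

fibColumn≡⊗ : (col : (m : ℕ) → Array (F m) 1) (y : Bool) →
  col 0 ≡ (letter false y V.∷ V.[]) V.∷ V.[] →
  col 1 ≡ (letter true y V.∷ V.[]) V.∷ V.[] →
  (∀ m → col (suc (suc m)) ≡ col (suc m) ∘r col m) →
  ∀ m → col m ≡ fibWord m ⊗ (y V.∷ V.[])
fibColumn≡⊗ col y col₀ col₁ step zero          = col₀
fibColumn≡⊗ col y col₀ col₁ step (suc zero)    = col₁
fibColumn≡⊗ col y col₀ col₁ step (suc (suc m)) = begin
  col (suc (suc m))                                  ≡⟨ step m ⟩
  col (suc m) ∘r col m                               ≡⟨ cong₂ _∘r_ (fibColumn≡⊗ col y col₀ col₁ step (suc m))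
                                                                   (fibColumn≡⊗ col y col₀ col₁ step m) ⟩
  (fibWord (suc m) ⊗ y′) ∘r (fibWord m ⊗ y′)        ≡⟨ sym (⊗-++ˡ (fibWord (suc m)) (fibWord m) y′) ⟩
  fibWord (suc (suc m)) ⊗ y′                         ∎
  where open ≡-Reasoning
        y′ = y V.∷ V.[]

fib≡fibWord⊗fibWord : ∀ m n → fib m n ≡ fibWord m ⊗ fibWord n
fib≡fibWord⊗fibWord m zero          = fibColumn≡⊗ fibCol0 false refl refl (λ _ → refl) m
fib≡fibWord⊗fibWord m (suc zero)    = fibColumn≡⊗ fibCol1 true refl refl (λ _ → refl) m
fib≡fibWord⊗fibWord m (suc (suc n)) = begin
  fib m (suc n) ∘c fib m n                              ≡⟨ cong₂ _∘c_ (fib≡fibWord⊗fibWord m (suc n))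
                                                                      (fib≡fibWord⊗fibWord m n) ⟩
  (fibWord m ⊗ fibWord (suc n)) ∘c (fibWord m ⊗ fibWord n) ≡⟨ sym (⊗-++ʳ (fibWord m) (fibWord (suc n)) (fibWord n)) ⟩
  fibWord m ⊗ fibWord (suc (suc n))                      ∎
  where open ≡-Reasoning

extent : Bool → ℕ
extent true  = 2
extent false = 1

μrows-letter : ∀ x y → μrows (letter x y) ≡ extent x
μrows-letter false false = refl
μrows-letter false true  = refl
μrows-letter true  false = refl
μrows-letter true  true  = refl

μcols-letter : ∀ x y → μcols (letter x y) ≡ extent y
μcols-letter false false = refl
μcols-letter false true  = refl
μcols-letter true  false = refl
μcols-letter true  true  = refl

lookup-⊗ : ∀ {p q} (r : Vec Bool p) (s : Vec Bool q) i j →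
  lookup (lookup (r ⊗ s) i) j ≡ letter (lookup r i) (lookup s j)
lookup-⊗ r s i j = begin
  lookup (lookup (r ⊗ s) i) j              ≡⟨ cong (λ row → lookup row j) (VP.lookup-map i _ r) ⟩
  lookup (V.map (letter (lookup r i)) s) j ≡⟨ VP.lookup-map j _ s ⟩
  letter (lookup r i) (lookup s j)         ∎
  where open ≡-Reasoning

⊗-μDefined : ∀ {p q} (r : Vec Bool p) (s : Vec Bool q) → μDefined (r ⊗ s)
⊗-μDefined r s =
  (λ i j j′ → trans (rows≡ i j) (sym (rows≡ i j′))) ,
  (λ i i′ j → trans (cols≡ i j) (sym (cols≡ i′ j)))
  where
  rows≡ : ∀ i j → μrows (lookup (lookup (r ⊗ s) i) j) ≡ extent (lookup r i)
  rows≡ i j = trans (cong μrows (lookup-⊗ r s i j)) (μrows-letter _ _)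

  cols≡ : ∀ i j → μcols (lookup (lookup (r ⊗ s) i) j) ≡ extent (lookup s j)
  cols≡ i j = trans (cong μcols (lookup-⊗ r s i j)) (μcols-letter _ _)

_⊗L_ : List Bool → List Bool → List (List Letter)
r ⊗L s = L.map (λ x → L.map (letter x) s) r

toRows-⊗ : ∀ {p q} (r : Vec Bool p) (s : Vec Bool q) →
  toRows (r ⊗ s) ≡ V.toList r ⊗L V.toList s
toRows-⊗ V.[]       s = refl
toRows-⊗ (x V.∷ r) s = cong₂ _∷_ (VP.toList-map (letter x) s) (toRows-⊗ r s)

⊗L-++ʳ : ∀ r s t → r ⊗L (s ++ t) ≡ (r ⊗L s) ∘cL (r ⊗L t)
⊗L-++ʳ []      s t = refl
⊗L-++ʳ (x ∷ r) s t = cong₂ _∷_ (LP.map-++ (letter x) s t) (⊗L-++ʳ r s t)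

fibStep : Bool → List Bool
fibStep true  = true ∷ false ∷ []
fibStep false = true ∷ []

fibMorphism : List Bool → List Bool
fibMorphism = L.concatMap fibStep

fibMorphism-fibWord : ∀ m → fibMorphism (V.toList (fibWord m)) ≡ V.toList (fibWord (suc m))
fibMorphism-fibWord zero          = refl
fibMorphism-fibWord (suc zero)    = refl
fibMorphism-fibWord (suc (suc m)) = begin
  fibMorphism (V.toList (fibWord (suc m) V.++ fibWord m))
    ≡⟨ cong fibMorphism (VP.toList-++ (fibWord (suc m)) (fibWord m)) ⟩
  fibMorphism (V.toList (fibWord (suc m)) ++ V.toList (fibWord m))
    ≡⟨ LP.concatMap-++ fibStep (V.toList (fibWord (suc m))) (V.toList (fibWord m)) ⟩
  fibMorphism (V.toList (fibWord (suc m))) ++ fibMorphism (V.toList (fibWord m))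
    ≡⟨ cong₂ _++_ (fibMorphism-fibWord (suc m)) (fibMorphism-fibWord m) ⟩
  V.toList (fibWord (suc (suc m))) ++ V.toList (fibWord (suc m))
    ≡⟨ sym (VP.toList-++ (fibWord (suc (suc m))) (fibWord (suc m))) ⟩
  V.toList (fibWord (suc (suc (suc m))))
    ∎
  where open ≡-Reasoning

fibWord-nonempty : ∀ m → V.toList (fibWord m) ≢ []
fibWord-nonempty zero          ()
fibWord-nonempty (suc zero)    ()
fibWord-nonempty (suc (suc m)) empty =
  fibWord-nonempty (suc m) (LP.++-conicalˡ _ _
    (trans (sym (VP.toList-++ (fibWord (suc m)) (fibWord m))) empty))

μL-letter : ∀ x y → μL (letter x y) ≡ fibStep x ⊗L fibStep y
μL-letter false false = refl
μL-letter false true  = refl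
μL-letter true  false = refl
μL-letter true  true  = refl

-- μRow [] is [] rather than a column of empty rows, hence nonemptiness.
μRow-letters : ∀ x s → s ≢ [] →
  μRow (L.map (letter x) s) ≡ fibStep x ⊗L fibMorphism s
μRow-letters x []           s≢[] = ⊥-elim (s≢[] refl)
μRow-letters x (y ∷ [])     _    =
  trans (μL-letter x y) (cong (fibStep x ⊗L_) (sym (LP.++-identityʳ (fibStep y))))
μRow-letters x (y ∷ y′ ∷ s) _    = begin
  μL (letter x y) ∘cL μRow (L.map (letter x) (y′ ∷ s))
    ≡⟨ cong₂ _∘cL_ (μL-letter x y) (μRow-letters x (y′ ∷ s) λ ()) ⟩
  (fibStep x ⊗L fibStep y) ∘cL (fibStep x ⊗L fibMorphism (y′ ∷ s))
    ≡⟨ sym (⊗L-++ʳ (fibStep x) (fibStep y) (fibMorphism (y′ ∷ s))) ⟩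
  fibStep x ⊗L fibMorphism (y ∷ y′ ∷ s)
    ∎
  where open ≡-Reasoning

μImage-⊗ : ∀ {p q} (r : Vec Bool p) (s : Vec Bool q) → V.toList s ≢ [] →
  μImage (r ⊗ s) ≡ fibMorphism (V.toList r) ⊗L fibMorphism (V.toList s)
μImage-⊗ r s s≢[] = begin
  μImage (r ⊗ s)
    ≡⟨ sym (LP.concatMap-map μRow V.toList (V.toList (r ⊗ s))) ⟩
  L.concatMap μRow (toRows (r ⊗ s))
    ≡⟨ cong (L.concatMap μRow) (toRows-⊗ r s) ⟩
  L.concatMap μRow (r′ ⊗L s′)
    ≡⟨ LP.concatMap-map μRow (λ x → L.map (letter x) s′) r′ ⟩
  L.concatMap (λ x → μRow (L.map (letter x) s′)) r′
    ≡⟨ LP.concatMap-cong (λ x → μRow-letters x s′ s≢[]) r′ ⟩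
  L.concatMap (λ x → fibStep x ⊗L fibMorphism s′) r′
    ≡⟨ sym (LP.map-concatMap (λ x → L.map (letter x) (fibMorphism s′)) fibStep r′) ⟩
  fibMorphism r′ ⊗L fibMorphism s′
    ∎
  where open ≡-Reasoning
        r′ = V.toList r
        s′ = V.toList s

-- The hypotheses 1 ≤ m and 1 ≤ n are unused: the identity holds for all m, n.
theorem12 : (m n : ℕ) → 1 ≤ m → 1 ≤ n →
    μDefined (fib m n) × (μImage (fib m n) ≡ toRows (fib (suc m) (suc n)))
theorem12 m n _ _ rewrite fib≡fibWord⊗fibWord m n | fib≡fibWord⊗fibWord (suc m) (suc n) =
  ⊗-μDefined (fibWord m) (fibWord n) , image
  where
  open ≡-Reasoning
  image : μImage (fibWord m ⊗ fibWord n) ≡ toRows (fibWord (suc m) ⊗ fibWord (suc n))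
  image = begin
    μImage (fibWord m ⊗ fibWord n)
      ≡⟨ μImage-⊗ (fibWord m) (fibWord n) (fibWord-nonempty n) ⟩
    fibMorphism (V.toList (fibWord m)) ⊗L fibMorphism (V.toList (fibWord n))
      ≡⟨ cong₂ _⊗L_ (fibMorphism-fibWord m) (fibMorphism-fibWord n) ⟩
    V.toList (fibWord (suc m)) ⊗L V.toList (fibWord (suc n))
      ≡⟨ sym (toRows-⊗ (fibWord (suc m)) (fibWord (suc n))) ⟩
    toRows (fibWord (suc m) ⊗ fibWord (suc n))
      ∎
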